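{- Let $G$ be a prime graph and let $a\neq b$ be two elements not in $V(G)$. Then there exists a prime graph $H$ with vertex set $V(G)\cup\{a,b\}$ such that $H[V(G)]=G$ and $a,b$ are not adjacent in $H$.
   Context: Graphs are finite, simple and undirected. For $W\subseteq V(H)$, $H[W]$ is the induced subgraph. A subset $M\subseteq V(G)$ is a module of $G$ if every $v\in V(G)\setminus M$ is adjacent either to all vertices of $M$ or to none of them; the modules $\emptyset$, $V(G)$ and the singletons are trivial. A graph $G$ is prime if $|V(G)|\geq 4$ and all its modules are trivial. -}

module Defs where

open import Data.Nat using (ℕ; suc; _≤_)
open import Data.Bool using (Bool; true; false)
open import Data.Fin using (Fin; zero; suc)
open import Data.Fin.Subset using (Subset; _∈_; _∉_; ⊥; ⊤; ⁅_⁆)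
open import Data.Product using (∃; _×_)
open import Data.Sum using (_⊎_)
open import Relation.Binary.PropositionalEquality using (_≡_)

record Graph (n : ℕ) : Set where
  field
    adj    : Fin n → Fin n → Bool
    sym    : ∀ i j → adj i j ≡ adj j i
    irrefl : ∀ i → adj i i ≡ false
open Graph public

IsModule : ∀ {n} → Graph n → Subset n → Set
IsModule {n} G M =
  ∀ (v : Fin n) → v ∉ M →
    (∀ x → x ∈ M → adj G v x ≡ true) ⊎ (∀ x → x ∈ M → adj G v x ≡ false)

Trivial : ∀ {n} → Subset n → Set
Trivial {n} M = (M ≡ ⊥) ⊎ (M ≡ ⊤) ⊎ ∃ (λ (x : Fin n) → M ≡ ⁅ x ⁆)

Prime : ∀ {n} → Graph n → Set
Prime {n} G = (4 ≤ n) × (∀ (M : Subset n) → IsModule G M → Trivial M)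

a b : ∀ {n} → Fin (suc (suc n))
a = zero
b = suc zero

old : ∀ {n} → Fin n → Fin (suc (suc n))
old i = suc (suc i)

module Submission where

-- Extend G
-- by a vertex a adjacent only to the old vertex 0 and a vertex b adjacent to
-- every old vertex, with a and b non-adjacent.  Given a module M of the
-- extension H, its trace on the old vertices is a module of G, hence is ∅,
-- all of V(G) or a singleton {y}.  In each of these three cases, and for each
-- choice of which of a, b lie in M, either M is trivial or some vertex outside
-- M distinguishes two members of M, so M was not a module after all.  The only
-- fact about G needed besides its modules being trivial is that no vertex of a
-- prime graph is universal (otherwise the complement of that vertex would be a
-- non-trivial module); it handles the case M = {b, y} with y ≠ 0.

open import Defs
open import Data.Nat using (ℕ; suc; z≤n; s≤s)
open import Data.Bool using (Bool; true; false; _≟_)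
open import Data.Bool.Properties using (¬-not)
open import Data.Fin using (Fin; zero; suc)
open import Data.Fin.Properties using (any?) renaming (_≟_ to _≟ᶠ_)
open import Data.Fin.Subset using (Subset; _∈_; _∉_; ⁅_⁆; ∁) renaming (⊥ to ∅; ⊤ to Full)
open import Data.Fin.Subset.Properties
  using (x∈⁅x⁆; x∈⁅y⁆⇒x≡y; x≢y⇒x∉⁅y⁆; ∈⊤; ∉⊥; x∈∁p⇒x∉p; x∉p⇒x∈∁p; x∉∁p⇒x∈p)
open import Data.Vec using (_∷_; here; there)
open import Data.Product using (Σ; ∃; _×_; _,_)
open import Data.Sum using (inj₁; inj₂)
open import Data.Empty using (⊥-elim)
open import Function using (_∘_)
open import Relation.Nullary using (¬_; yes; no; ¬?; _×-dec_)
open import Relation.Binary.PropositionalEquality using (_≡_; _≢_; refl; trans)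
  renaming (sym to ≡-sym)

ModulesTrivial : ∀ {n} → Graph n → Set
ModulesTrivial {n} G = ∀ (M : Subset n) → IsModule G M → Trivial M

separates : ∀ {n} {G : Graph n} {M : Subset n} (v x y : Fin n) →
  v ∉ M → x ∈ M → y ∈ M → adj G v x ≡ true → adj G v y ≡ false → ¬ IsModule G M
separates v x y v∉M x∈M y∈M vx vy isModule with isModule v v∉M
... | inj₁ allAdj  with () ← trans (≡-sym (allAdj y y∈M)) vy
... | inj₂ noneAdj with () ← trans (≡-sym vx) (noneAdj x x∈M)

nontrivial : ∀ {n} {M : Subset n} {y p q : Fin n} →
  y ∉ M → p ∈ M → q ∈ M → p ≢ q → ¬ Trivial M
nontrivial y∉M p∈M q∈M p≢q (inj₁ refl)              = ∉⊥ p∈M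
nontrivial y∉M p∈M q∈M p≢q (inj₂ (inj₁ refl))       = y∉M ∈⊤
nontrivial y∉M p∈M q∈M p≢q (inj₂ (inj₂ (x , refl))) =
  p≢q (trans (x∈⁅y⁆⇒x≡y x p∈M) (≡-sym (x∈⁅y⁆⇒x≡y x q∈M)))

twoOthers : ∀ {k} (y : Fin (suc (suc (suc k)))) →
  Σ (Fin (suc (suc (suc k)))) λ p → Σ (Fin (suc (suc (suc k)))) λ q →
    p ≢ y × q ≢ y × p ≢ q
twoOthers zero          = suc zero , suc (suc zero) , (λ ()) , (λ ()) , (λ ())
twoOthers (suc zero)    = zero , suc (suc zero) , (λ ()) , (λ ()) , (λ ())
twoOthers (suc (suc y)) = zero , suc zero , (λ ()) , (λ ()) , (λ ())

-- With at least three vertices and only trivial modules there is no universal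
-- vertex: if y were adjacent to all others, V ∖ {y} would be a module.
nonNeighbour : ∀ {k : ℕ} (G : Graph (suc (suc (suc k)))) → ModulesTrivial G →
  ∀ y → ∃ λ w → w ≢ y × adj G y w ≡ false
nonNeighbour {k} G trivial y with any? (λ w → ¬? (w ≟ᶠ y) ×-dec (adj G y w ≟ false))
... | yes found = found
... | no none   =
  let (p , q , p≢y , q≢y , p≢q) = twoOthers y in
  ⊥-elim (nontrivial y∉M (inM p≢y) (inM q≢y) p≢q (trivial M isModule))
  where
  M : Subset (suc (suc (suc k)))
  M = ∁ ⁅ y ⁆

  inM : ∀ {x} → x ≢ y → x ∈ M
  inM x≢y = x∉p⇒x∈∁p (x≢y⇒x∉⁅y⁆ x≢y)

  y∉M : y ∉ M
  y∉M y∈M = x∈∁p⇒x∉p y∈M (x∈⁅x⁆ y)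

  universal : ∀ x → x ≢ y → adj G y x ≡ true
  universal x x≢y = ¬-not (λ nonAdj → none (x , x≢y , nonAdj))

  isModule : IsModule G M
  isModule v v∉M with refl ← x∈⁅y⁆⇒x≡y y (x∉∁p⇒x∈p v∉M) =
    inj₁ (λ x x∈M → universal x (λ { refl → y∉M x∈M }))

old∈ : ∀ {n} {ma mb} {M : Subset n} {x} → x ∈ M → old x ∈ (ma ∷ mb ∷ M)
old∈ = there ∘ there

old∉ : ∀ {n} {ma mb} {M : Subset n} {x} → x ∉ M → old x ∉ (ma ∷ mb ∷ M)
old∉ x∉M (there (there x∈M)) = x∉M x∈M

a∉ : ∀ {n} {mb} {M : Subset n} → a ∉ (false ∷ mb ∷ M)
a∉ ()

b∉ : ∀ {n} {ma} {M : Subset n} → b ∉ (ma ∷ false ∷ M)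
b∉ (there ())

b∈ : ∀ {n} {ma} {M : Subset n} → b ∈ (ma ∷ true ∷ M)
b∈ = there here

restrict : ∀ {n} {G : Graph n} {H : Graph (suc (suc n))} →
  (∀ i j → adj H (old i) (old j) ≡ adj G i j) →
  ∀ {ma mb} {M : Subset n} → IsModule H (ma ∷ mb ∷ M) → IsModule G M
restrict induced isModule v v∉M with isModule (old v) (old∉ v∉M)
... | inj₁ allAdj  = inj₁ (λ x x∈M → trans (≡-sym (induced v x)) (allAdj (old x) (old∈ x∈M)))
... | inj₂ noneAdj = inj₂ (λ x x∈M → trans (≡-sym (induced v x)) (noneAdj (old x) (old∈ x∈M)))

module Extension {m : ℕ} (G : Graph (suc m)) where

  isZero : ∀ {n} → Fin n → Bool
  isZero zero    = true
  isZero (suc _) = false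

  adjH : Fin (suc (suc (suc m))) → Fin (suc (suc (suc m))) → Bool
  adjH zero          zero          = false
  adjH zero          (suc zero)    = false
  adjH zero          (suc (suc j)) = isZero j
  adjH (suc zero)    zero          = false
  adjH (suc zero)    (suc zero)    = false
  adjH (suc zero)    (suc (suc j)) = true
  adjH (suc (suc i)) zero          = isZero i
  adjH (suc (suc i)) (suc zero)    = true
  adjH (suc (suc i)) (suc (suc j)) = adj G i j

  symH : ∀ i j → adjH i j ≡ adjH j i
  symH zero          zero          = refl
  symH zero          (suc zero)    = refl
  symH zero          (suc (suc j)) = refl
  symH (suc zero)    zero          = refl
  symH (suc zero)    (suc zero)    = refl
  symH (suc zero)    (suc (suc j)) = refl
  symH (suc (suc i)) zero          = refl
  symH (suc (suc i)) (suc zero)    = refl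
  symH (suc (suc i)) (suc (suc j)) = sym G i j

  irreflH : ∀ i → adjH i i ≡ false
  irreflH zero          = refl
  irreflH (suc zero)    = refl
  irreflH (suc (suc i)) = irrefl G i

  H : Graph (suc (suc (suc m)))
  H = record { adj = adjH ; sym = symH ; irrefl = irreflH }

module ExtensionModules {k : ℕ} (G : Graph (suc (suc (suc k)))) where
  open Extension G

  N : ℕ
  N = suc (suc (suc k))

  -- Trace ∅: only {a, b} is non-trivial, and old 1 separates it.
  traceEmpty : ∀ ma mb → IsModule H (ma ∷ mb ∷ ∅ {N}) → Trivial (ma ∷ mb ∷ ∅ {N})
  traceEmpty false false _ = inj₁ refl
  traceEmpty true  false _ = inj₂ (inj₂ (a , refl))
  traceEmpty false true  _ = inj₂ (inj₂ (b , refl))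
  traceEmpty true  true  isModule =
    ⊥-elim (separates {G = H} (old (suc zero)) b a (old∉ (∉⊥ {N})) b∈ here refl refl isModule)

  -- Trace V(G): a separates old 0 from old 1, and b separates old 0 from a.
  traceFull : ∀ ma mb → IsModule H (ma ∷ mb ∷ Full {N}) → Trivial (ma ∷ mb ∷ Full {N})
  traceFull true  true  _ = inj₂ (inj₁ refl)
  traceFull false mb    isModule =
    ⊥-elim (separates {G = H} a (old zero) (old (suc zero)) a∉ (old∈ (∈⊤ {N})) (old∈ (∈⊤ {N})) refl refl isModule)
  traceFull true  false isModule =
    ⊥-elim (separates {G = H} b (old zero) a b∉ (old∈ (∈⊤ {N})) here refl refl isModule)

  -- A vertex of G other than 0 and y, for the case M = {a, b, y}.
  avoidZeroAnd : (y : Fin (suc (suc (suc k)))) → ∃ λ w → suc w ≢ y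
  avoidZeroAnd zero          = zero , λ ()
  avoidZeroAnd (suc zero)    = suc zero , λ ()
  avoidZeroAnd (suc (suc y)) = zero , λ ()

  -- Trace {y}: the separating vertex is b, a, a non-neighbour of y, or an old
  -- vertex other than 0 and y, according to which of a, b lie in M.
  traceSingleton : ModulesTrivial G → ∀ ma mb y →
    IsModule H (ma ∷ mb ∷ ⁅ y ⁆) → Trivial (ma ∷ mb ∷ ⁅ y ⁆)
  traceSingleton _ false false y _ = inj₂ (inj₂ (old y , refl))
  traceSingleton _ true  false y isModule =
    ⊥-elim (separates {G = H} b (old y) a b∉ (old∈ (x∈⁅x⁆ y)) here refl refl isModule)
  traceSingleton _ false true  zero isModule =
    ⊥-elim (separates {G = H} a (old zero) b a∉ (old∈ (x∈⁅x⁆ zero)) b∈ refl refl isModule)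
  traceSingleton trivial false true (suc y) isModule =
    let (w , w≢y , nonAdj) = nonNeighbour G trivial (suc y) in
    ⊥-elim (separates {G = H} (old w) b (old (suc y)) (old∉ (x≢y⇒x∉⁅y⁆ w≢y)) b∈ (old∈ (x∈⁅x⁆ (suc y)))
              refl (trans (sym G w (suc y)) nonAdj) isModule)
  traceSingleton _ true  true  y isModule =
    let (w , sw≢y) = avoidZeroAnd y in
    ⊥-elim (separates {G = H} (old (suc w)) b a (old∉ (x≢y⇒x∉⁅y⁆ sw≢y)) b∈ here refl refl isModule)

  extensionModulesTrivial : ModulesTrivial G → ModulesTrivial H
  extensionModulesTrivial trivial (ma ∷ mb ∷ M) isModule
    with trivial M (restrict {G = G} {H = H} (λ _ _ → refl) isModule)
  ... | inj₁ refl              = traceEmpty ma mb isModule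
  ... | inj₂ (inj₁ refl)       = traceFull ma mb isModule
  ... | inj₂ (inj₂ (y , refl)) = traceSingleton trivial ma mb y isModule

corollary2 : ∀ (n : ℕ) (G : Graph n) → Prime G →
    Σ (Graph (suc (suc n))) (λ H →
    Prime H
    × (∀ (i j : Fin n) → adj H (old i) (old j) ≡ adj G i j)
    × (adj H a b ≡ false))
corollary2 (suc (suc (suc (suc k)))) G (s≤s (s≤s (s≤s (s≤s z≤n))) , trivial) =
  H , (s≤s (s≤s (s≤s (s≤s z≤n))) , extensionModulesTrivial trivial) , (λ _ _ → refl) , refl
  where
  open Extension G using (H)
  open ExtensionModules G using (extensionModulesTrivial)
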